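{- If a sequent $S$ is derivable in $\mathbf{GA_s}$, then $\models_{\mathbf{A}} S$.
   Context: Formulas are built from propositional variables and $t$ using $+,\to,\Rightarrow$ (binary) and $\lnot$; a valuation $v$ into $\mathbb{Q}$ satisfies $v(t)=0$, $v(A+B)=v(A)+v(B)$, $v(\lnot A)=-v(A)$, $v(A\to B)=v(B)-v(A)$, $v(A\Rightarrow B)=\min(0,v(B)-v(A))$ (i.e. $A\Rightarrow B=(A\to B)\land t$). A sequent $\Gamma\vdash\Delta$ is a pair of finite multisets of formulas; $\models_{\mathbf{A}}\Gamma\vdash\Delta$ means $\sum_{A\in\Gamma}v(A)\le\sum_{B\in\Delta}v(B)$ for every valuation $v$ (empty sum $0$), equivalently $(\sum\Gamma)\to(\sum\Delta)$ is valid in all lattice-ordered abelian groups. Calculus $\mathbf{GA_s}$ (premise(s) / conclusion; commas are multiset union): axioms $A\vdash A$ and $\vdash$; (W) $\Gamma\vdash\Delta/\Gamma,A\Rightarrow B\vdash\Delta$; (M) premises $\Gamma_1\vdash\Delta_1$ and $\Gamma_2\vdash\Delta_2$, conclusion $\Gamma_1,\Gamma_2\vdash\Delta_1,\Delta_2$; (C) from $\Gamma,\ldots,\Gamma\vdash\Delta,\ldots,\Delta$ ($n$ copies of each, $n>0$) infer $\Gamma\vdash\Delta$; $(t,l)$ $\Gamma\vdash\Delta/\Gamma,t\vdash\Delta$; $(t,r)$ $\Gamma\vdash\Delta/\Gamma\vdash t,\Delta$; $(\lnot,l)$ $\Gamma\vdash A,\Delta/\Gamma,\lnot A\vdash\Delta$;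 $(\lnot,r)$ $\Gamma,A\vdash\Delta/\Gamma\vdash\lnot A,\Delta$; $(\to,l)$ $\Gamma,B\vdash A,\Delta/\Gamma,A\to B\vdash\Delta$; $(\to,r)$ $\Gamma,A\vdash B,\Delta/\Gamma\vdash A\to B,\Delta$; $(+,l)$ $\Gamma,A,B\vdash\Delta/\Gamma,A+B\vdash\Delta$; $(+,r)$ $\Gamma\vdash A,B,\Delta/\Gamma\vdash A+B,\Delta$; $(\Rightarrow,l)$ $\Gamma,B,B\Rightarrow A\vdash\Delta,A/\Gamma,A\Rightarrow B\vdash\Delta$; $(\Rightarrow,r)$ premises $\Gamma\vdash\Delta$ and $\Gamma,A\vdash\Delta,B$, conclusion $\Gamma\vdash\Delta,A\Rightarrow B$. -}

module Defs where

open import Data.Nat using (ℕ; suc)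
open import Data.List using (List; []; _∷_; _++_; concat; replicate; foldr; map)
open import Data.List.Relation.Binary.Permutation.Propositional using (_↭_)
open import Data.Rational using (ℚ; 0ℚ; _+_; _-_; -_; _⊓_; _≤_)

data Formula : Set where
  var  : ℕ → Formula
  t    : Formula
  _⊕_  : Formula → Formula → Formula
  _⟶_  : Formula → Formula → Formula
  _⟹_  : Formula → Formula → Formula
  ¬'_  : Formula → Formula

infixr 6 _⊕_
infixr 5 _⟶_ _⟹_

Valuation : Set
Valuation = ℕ → ℚ

⟦_⟧ : Formula → Valuation → ℚ
⟦ var n ⟧ v   = v n
⟦ t ⟧ v       = 0ℚ
⟦ A ⊕ B ⟧ v   = ⟦ A ⟧ v + ⟦ B ⟧ v
⟦ A ⟶ B ⟧ v   = ⟦ B ⟧ v - ⟦ A ⟧ v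
⟦ A ⟹ B ⟧ v   = 0ℚ ⊓ (⟦ B ⟧ v - ⟦ A ⟧ v)
⟦ ¬' A ⟧ v    = - ⟦ A ⟧ v

Σ⟦_⟧ : List Formula → Valuation → ℚ
Σ⟦ Γ ⟧ v = foldr _+_ 0ℚ (map (λ A → ⟦ A ⟧ v) Γ)

-- Sequents: pairs of finite multisets, represented by lists;
-- multiset equality is handled by the permutation rule (perm) below.
record Sequent : Set where
  constructor _⊢_
  field
    ante : List Formula
    succ : List Formula

infix 4 _⊢_

⊨A : Sequent → Set
⊨A (Γ ⊢ Δ) = (v : Valuation) → Σ⟦ Γ ⟧ v ≤ Σ⟦ Δ ⟧ v

copies : ℕ → List Formula → List Formula
copies n Γ = concat (replicate n Γ)

data GAs : Sequent → Set where
  perm  : ∀ {Γ Γ' Δ Δ'} → Γ ↭ Γ' → Δ ↭ Δ' → GAs (Γ ⊢ Δ) → GAs (Γ' ⊢ Δ')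
  ax    : ∀ {A} → GAs ((A ∷ []) ⊢ (A ∷ []))
  empty : GAs ([] ⊢ [])
  W     : ∀ {Γ Δ A B} → GAs (Γ ⊢ Δ) → GAs ((Γ ++ (A ⟹ B) ∷ []) ⊢ Δ)
  M     : ∀ {Γ₁ Δ₁ Γ₂ Δ₂} → GAs (Γ₁ ⊢ Δ₁) → GAs (Γ₂ ⊢ Δ₂)
        → GAs ((Γ₁ ++ Γ₂) ⊢ (Δ₁ ++ Δ₂))
  C     : ∀ {Γ Δ} (n : ℕ) → GAs (copies (suc n) Γ ⊢ copies (suc n) Δ) → GAs (Γ ⊢ Δ)
  tl    : ∀ {Γ Δ} → GAs (Γ ⊢ Δ) → GAs ((Γ ++ t ∷ []) ⊢ Δ)
  tr    : ∀ {Γ Δ} → GAs (Γ ⊢ Δ) → GAs (Γ ⊢ (t ∷ Δ))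
  ¬l    : ∀ {Γ Δ A} → GAs (Γ ⊢ (A ∷ Δ)) → GAs ((Γ ++ ¬' A ∷ []) ⊢ Δ)
  ¬r    : ∀ {Γ Δ A} → GAs ((Γ ++ A ∷ []) ⊢ Δ) → GAs (Γ ⊢ (¬' A ∷ Δ))
  →l    : ∀ {Γ Δ A B} → GAs ((Γ ++ B ∷ []) ⊢ (A ∷ Δ)) → GAs ((Γ ++ (A ⟶ B) ∷ []) ⊢ Δ)
  →r    : ∀ {Γ Δ A B} → GAs ((Γ ++ A ∷ []) ⊢ (B ∷ Δ)) → GAs (Γ ⊢ ((A ⟶ B) ∷ Δ))
  +l    : ∀ {Γ Δ A B} → GAs ((Γ ++ A ∷ B ∷ []) ⊢ Δ) → GAs ((Γ ++ (A ⊕ B) ∷ []) ⊢ Δ)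
  +r    : ∀ {Γ Δ A B} → GAs (Γ ⊢ (A ∷ B ∷ Δ)) → GAs (Γ ⊢ ((A ⊕ B) ∷ Δ))
  ⇒l    : ∀ {Γ Δ A B} → GAs ((Γ ++ B ∷ (B ⟹ A) ∷ []) ⊢ (Δ ++ A ∷ []))
        → GAs ((Γ ++ (A ⟹ B) ∷ []) ⊢ Δ)
  ⇒r    : ∀ {Γ Δ A B} → GAs (Γ ⊢ Δ) → GAs ((Γ ++ A ∷ []) ⊢ (Δ ++ B ∷ []))
        → GAs (Γ ⊢ (Δ ++ (A ⟹ B) ∷ []))

-- Validity of Γ ⊢ Δ means that its defect Σ v(Γ) − Σ v(Δ) is never positive, and the rules
-- preserve this: the logical rules other than (⇒,r) leave the defect unchanged, (M) adds
-- defects, (W) adds the nonpositive value of A ⇒ B, and (C) cancels a positive integer factor.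
-- (⇒,r) holds because min(0, y) is the greatest lower bound of 0 and y, and (⇒,l) because
-- v(A ⇒ B) = v(A → B) + v(B ⇒ A).
module Submission where

open import Defs

open import Data.Nat using (zero; suc)
open import Data.List using ([]; _∷_; _++_)
open import Data.List.Properties using (++-assoc)
open import Data.List.Relation.Binary.Permutation.Propositional using (_↭_; ↭⇒↭ₛ)
open import Data.List.Relation.Binary.Permutation.Propositional.Properties using (map⁺)
open import Data.List.Relation.Binary.Permutation.Setoid.Properties using (foldr-commMonoid)
open import Data.Rational using (ℚ; 0ℚ; _+_; _-_; -_; _⊓_; _≤_; _<_)
open import Data.Rational.Properties
  using (≤-refl; ≮⇒≥; <-irrefl; <-≤-trans; +-mono-<; +-mono-≤; +-monoˡ-≤;
         +-assoc; +-comm; +-identityˡ; +-identityʳ; +-inverseʳ; +-0-isCommutativeMonoid;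
         ⊓-comm; ⊓-glb; p⊓q≤p; mono-≤-distrib-⊓)
open import Data.Rational.Solver using (module +-*-Solver)
open import Relation.Binary.PropositionalEquality
  using (_≡_; refl; sym; trans; cong; cong₂; subst; subst₂; setoid; module ≡-Reasoning)

open +-*-Solver using (solve; _:=_; _:+_; _:-_; :-_; con)
open ≡-Reasoning

p≤q⇒p-q≤0 : ∀ {p q} → p ≤ q → p - q ≤ 0ℚ
p≤q⇒p-q≤0 {p} {q} p≤q = subst (p - q ≤_) (+-inverseʳ q) (+-monoˡ-≤ (- q) p≤q)

p-q≤0⇒p≤q : ∀ {p q} → p - q ≤ 0ℚ → p ≤ q
p-q≤0⇒p≤q {p} {q} p-q≤0 = subst₂ _≤_ (p-q+q≡p p q) (+-identityˡ q) (+-monoˡ-≤ q p-q≤0)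
  where
  p-q+q≡p : ∀ p q → (p - q) + q ≡ p
  p-q+q≡p = solve 2 (λ p q → (p :- q) :+ q := p) refl

p-[q-r]≡[p+r]-q : ∀ p q r → p - (q - r) ≡ (p + r) - q
p-[q-r]≡[p+r]-q = solve 3 (λ p q r → p :- (q :- r) := (p :+ r) :- q) refl

0⊓[q-p]≡q-p+0⊓[p-q] : ∀ p q → 0ℚ ⊓ (q - p) ≡ (q - p) + 0ℚ ⊓ (p - q)
0⊓[q-p]≡q-p+0⊓[p-q] p q = begin
  0ℚ ⊓ (q - p)                          ≡⟨ cong₂ _⊓_ (sym (p-q+[q-p]≡0 p q)) (sym (+-identityˡ (q - p))) ⟩
  ((p - q) + (q - p)) ⊓ (0ℚ + (q - p))  ≡⟨ mono-≤-distrib-⊓ (+-monoˡ-≤ (q - p)) (p - q) 0ℚ ⟨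
  (p - q) ⊓ 0ℚ + (q - p)                ≡⟨ +-comm ((p - q) ⊓ 0ℚ) (q - p) ⟩
  (q - p) + (p - q) ⊓ 0ℚ                ≡⟨ cong ((q - p) +_) (⊓-comm (p - q) 0ℚ) ⟩
  (q - p) + 0ℚ ⊓ (p - q)                ∎
  where
  p-q+[q-p]≡0 : ∀ p q → (p - q) + (q - p) ≡ 0ℚ
  p-q+[q-p]≡0 = solve 2 (λ p q → (p :- q) :+ (q :- p) := con 0ℚ) refl

Σ-++ : ∀ Γ Π v → Σ⟦ Γ ++ Π ⟧ v ≡ Σ⟦ Γ ⟧ v + Σ⟦ Π ⟧ v
Σ-++ []      Π v = sym (+-identityˡ (Σ⟦ Π ⟧ v))
Σ-++ (A ∷ Γ) Π v = trans (cong (⟦ A ⟧ v +_) (Σ-++ Γ Π v)) (sym (+-assoc (⟦ A ⟧ v) (Σ⟦ Γ ⟧ v) (Σ⟦ Π ⟧ v)))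

Σ-↭ : ∀ {Γ Γ'} → Γ ↭ Γ' → ∀ v → Σ⟦ Γ ⟧ v ≡ Σ⟦ Γ' ⟧ v
Σ-↭ Γ↭Γ' v = foldr-commMonoid (setoid ℚ) +-0-isCommutativeMonoid (↭⇒↭ₛ (map⁺ (λ A → ⟦ A ⟧ v) Γ↭Γ'))

defect : Sequent → Valuation → ℚ
defect (Γ ⊢ Δ) v = Σ⟦ Γ ⟧ v - Σ⟦ Δ ⟧ v

defect-++ : ∀ Γ₁ Γ₂ Δ₁ Δ₂ v → defect (Γ₁ ++ Γ₂ ⊢ Δ₁ ++ Δ₂) v ≡ defect (Γ₁ ⊢ Δ₁) v + defect (Γ₂ ⊢ Δ₂) v
defect-++ Γ₁ Γ₂ Δ₁ Δ₂ v = begin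
  Σ⟦ Γ₁ ++ Γ₂ ⟧ v - Σ⟦ Δ₁ ++ Δ₂ ⟧ v           ≡⟨ cong₂ _-_ (Σ-++ Γ₁ Γ₂ v) (Σ-++ Δ₁ Δ₂ v) ⟩
  (G₁ + G₂) - (D₁ + D₂)                       ≡⟨ interchange G₁ G₂ D₁ D₂ ⟩
  (G₁ - D₁) + (G₂ - D₂)                       ∎
  where
  G₁ = Σ⟦ Γ₁ ⟧ v; G₂ = Σ⟦ Γ₂ ⟧ v; D₁ = Σ⟦ Δ₁ ⟧ v; D₂ = Σ⟦ Δ₂ ⟧ v
  interchange : ∀ p q r s → (p + q) - (r + s) ≡ (p - r) + (q - s)
  interchange = solve 4 (λ p q r s → (p :+ q) :- (r :+ s) := (p :- r) :+ (q :- s)) refl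

defect-ante-∷ʳ : ∀ Γ A Δ v → defect (Γ ++ A ∷ [] ⊢ Δ) v ≡ defect (Γ ⊢ Δ) v + ⟦ A ⟧ v
defect-ante-∷ʳ Γ A Δ v = begin
  Σ⟦ Γ ++ A ∷ [] ⟧ v - Σ⟦ Δ ⟧ v   ≡⟨ cong (_- Σ⟦ Δ ⟧ v) (Σ-++ Γ (A ∷ []) v) ⟩
  (G + (a + 0ℚ)) - Σ⟦ Δ ⟧ v       ≡⟨ shuffle G a (Σ⟦ Δ ⟧ v) ⟩
  (G - Σ⟦ Δ ⟧ v) + a              ∎
  where
  G = Σ⟦ Γ ⟧ v; a = ⟦ A ⟧ v
  shuffle : ∀ p q r → (p + (q + 0ℚ)) - r ≡ (p - r) + q
  shuffle = solve 3 (λ p q r → (p :+ (q :+ con 0ℚ)) :- r := (p :- r) :+ q) refl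

defect-succ-∷ : ∀ Γ A Δ v → defect (Γ ⊢ A ∷ Δ) v ≡ defect (Γ ⊢ Δ) v - ⟦ A ⟧ v
defect-succ-∷ Γ A Δ v = shuffle (Σ⟦ Γ ⟧ v) (⟦ A ⟧ v) (Σ⟦ Δ ⟧ v)
  where
  shuffle : ∀ p q r → p - (q + r) ≡ (p - r) - q
  shuffle = solve 3 (λ p q r → p :- (q :+ r) := (p :- r) :- q) refl

defect-succ-∷ʳ : ∀ Γ Δ A v → defect (Γ ⊢ Δ ++ A ∷ []) v ≡ defect (Γ ⊢ Δ) v - ⟦ A ⟧ v
defect-succ-∷ʳ Γ Δ A v = begin
  Σ⟦ Γ ⟧ v - Σ⟦ Δ ++ A ∷ [] ⟧ v   ≡⟨ cong (λ x → Σ⟦ Γ ⟧ v - x) (Σ-++ Δ (A ∷ []) v) ⟩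
  Σ⟦ Γ ⟧ v - (D + (a + 0ℚ))       ≡⟨ shuffle (Σ⟦ Γ ⟧ v) D a ⟩
  (Σ⟦ Γ ⟧ v - D) - a              ∎
  where
  D = Σ⟦ Δ ⟧ v; a = ⟦ A ⟧ v
  shuffle : ∀ p q r → p - (q + (r + 0ℚ)) ≡ (p - q) - r
  shuffle = solve 3 (λ p q r → p :- (q :+ (r :+ con 0ℚ)) := (p :- q) :- r) refl

defect-↭ : ∀ {Γ Γ' Δ Δ'} → Γ ↭ Γ' → Δ ↭ Δ' → ∀ v → defect (Γ ⊢ Δ) v ≡ defect (Γ' ⊢ Δ') v
defect-↭ Γ↭Γ' Δ↭Δ' v = cong₂ _-_ (Σ-↭ Γ↭Γ' v) (Σ-↭ Δ↭Δ' v)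

copies-defect-pos : ∀ n Γ Δ v → 0ℚ < defect (Γ ⊢ Δ) v → 0ℚ < defect (copies (suc n) Γ ⊢ copies (suc n) Δ) v
copies-defect-pos zero Γ Δ v pos =
  subst (0ℚ <_) (sym (trans (defect-++ Γ [] Δ [] v) (+-identityʳ (defect (Γ ⊢ Δ) v)))) pos
copies-defect-pos (suc n) Γ Δ v pos =
  subst (0ℚ <_) (sym (defect-++ Γ (copies (suc n) Γ) Δ (copies (suc n) Δ) v))
    (+-mono-< pos (copies-defect-pos n Γ Δ v pos))

copies-defect-nonpos : ∀ n Γ Δ v → defect (copies (suc n) Γ ⊢ copies (suc n) Δ) v ≤ 0ℚ → defect (Γ ⊢ Δ) v ≤ 0ℚ
copies-defect-nonpos n Γ Δ v nonpos =
  ≮⇒≥ (λ pos → <-irrefl refl (<-≤-trans (copies-defect-pos n Γ Δ v pos) nonpos))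

defect-tl : ∀ Γ Δ v → defect (Γ ++ t ∷ [] ⊢ Δ) v ≡ defect (Γ ⊢ Δ) v
defect-tl Γ Δ v = trans (defect-ante-∷ʳ Γ t Δ v) (+-identityʳ (defect (Γ ⊢ Δ) v))

defect-tr : ∀ Γ Δ v → defect (Γ ⊢ t ∷ Δ) v ≡ defect (Γ ⊢ Δ) v
defect-tr Γ Δ v = trans (defect-succ-∷ Γ t Δ v) (+-identityʳ (defect (Γ ⊢ Δ) v))

defect-¬l : ∀ Γ Δ A v → defect (Γ ++ ¬' A ∷ [] ⊢ Δ) v ≡ defect (Γ ⊢ A ∷ Δ) v
defect-¬l Γ Δ A v = trans (defect-ante-∷ʳ Γ (¬' A) Δ v) (sym (defect-succ-∷ Γ A Δ v))

defect-¬r : ∀ Γ Δ A v → defect (Γ ⊢ ¬' A ∷ Δ) v ≡ defect (Γ ++ A ∷ [] ⊢ Δ) v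
defect-¬r Γ Δ A v = begin
  defect (Γ ⊢ ¬' A ∷ Δ) v         ≡⟨ defect-succ-∷ Γ (¬' A) Δ v ⟩
  defect (Γ ⊢ Δ) v - (- ⟦ A ⟧ v)  ≡⟨ p-[-q]≡p+q (defect (Γ ⊢ Δ) v) (⟦ A ⟧ v) ⟩
  defect (Γ ⊢ Δ) v + ⟦ A ⟧ v      ≡⟨ defect-ante-∷ʳ Γ A Δ v ⟨
  defect (Γ ++ A ∷ [] ⊢ Δ) v      ∎
  where
  p-[-q]≡p+q : ∀ p q → p - (- q) ≡ p + q
  p-[-q]≡p+q = solve 2 (λ p q → p :- (:- q) := p :+ q) refl

defect-→l : ∀ Γ Δ A B v → defect (Γ ++ (A ⟶ B) ∷ [] ⊢ Δ) v ≡ defect (Γ ++ B ∷ [] ⊢ A ∷ Δ) v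
defect-→l Γ Δ A B v = begin
  defect (Γ ++ (A ⟶ B) ∷ [] ⊢ Δ) v    ≡⟨ defect-ante-∷ʳ Γ (A ⟶ B) Δ v ⟩
  d + (b - a)                          ≡⟨ +-assoc d b (- a) ⟨
  (d + b) - a                          ≡⟨ cong (_- a) (defect-ante-∷ʳ Γ B Δ v) ⟨
  defect (Γ ++ B ∷ [] ⊢ Δ) v - a       ≡⟨ defect-succ-∷ (Γ ++ B ∷ []) A Δ v ⟨
  defect (Γ ++ B ∷ [] ⊢ A ∷ Δ) v       ∎
  where
  d = defect (Γ ⊢ Δ) v; a = ⟦ A ⟧ v; b = ⟦ B ⟧ v

defect-→r : ∀ Γ Δ A B v → defect (Γ ⊢ (A ⟶ B) ∷ Δ) v ≡ defect (Γ ++ A ∷ [] ⊢ B ∷ Δ) v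
defect-→r Γ Δ A B v = begin
  defect (Γ ⊢ (A ⟶ B) ∷ Δ) v          ≡⟨ defect-succ-∷ Γ (A ⟶ B) Δ v ⟩
  d - (b - a)                          ≡⟨ p-[q-r]≡[p+r]-q d b a ⟩
  (d + a) - b                          ≡⟨ cong (_- b) (defect-ante-∷ʳ Γ A Δ v) ⟨
  defect (Γ ++ A ∷ [] ⊢ Δ) v - b       ≡⟨ defect-succ-∷ (Γ ++ A ∷ []) B Δ v ⟨
  defect (Γ ++ A ∷ [] ⊢ B ∷ Δ) v       ∎
  where
  d = defect (Γ ⊢ Δ) v; a = ⟦ A ⟧ v; b = ⟦ B ⟧ v

defect-+l : ∀ Γ Δ A B v → defect (Γ ++ (A ⊕ B) ∷ [] ⊢ Δ) v ≡ defect (Γ ++ A ∷ B ∷ [] ⊢ Δ) v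
defect-+l Γ Δ A B v = begin
  defect (Γ ++ (A ⊕ B) ∷ [] ⊢ Δ) v            ≡⟨ defect-ante-∷ʳ Γ (A ⊕ B) Δ v ⟩
  d + (a + b)                                 ≡⟨ +-assoc d a b ⟨
  (d + a) + b                                 ≡⟨ cong (_+ b) (defect-ante-∷ʳ Γ A Δ v) ⟨
  defect (Γ ++ A ∷ [] ⊢ Δ) v + b              ≡⟨ defect-ante-∷ʳ (Γ ++ A ∷ []) B Δ v ⟨
  defect ((Γ ++ A ∷ []) ++ B ∷ [] ⊢ Δ) v      ≡⟨ cong (λ Π → defect (Π ⊢ Δ) v) (++-assoc Γ (A ∷ []) (B ∷ [])) ⟩
  defect (Γ ++ A ∷ B ∷ [] ⊢ Δ) v              ∎
  where
  d = defect (Γ ⊢ Δ) v; a = ⟦ A ⟧ v; b = ⟦ B ⟧ v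

defect-+r : ∀ Γ Δ A B v → defect (Γ ⊢ (A ⊕ B) ∷ Δ) v ≡ defect (Γ ⊢ A ∷ B ∷ Δ) v
defect-+r Γ Δ A B v = begin
  defect (Γ ⊢ (A ⊕ B) ∷ Δ) v       ≡⟨ defect-succ-∷ Γ (A ⊕ B) Δ v ⟩
  d - (a + b)                       ≡⟨ p-[q+r]≡[p-r]-q d a b ⟩
  (d - b) - a                       ≡⟨ cong (_- a) (defect-succ-∷ Γ B Δ v) ⟨
  defect (Γ ⊢ B ∷ Δ) v - a          ≡⟨ defect-succ-∷ Γ A (B ∷ Δ) v ⟨
  defect (Γ ⊢ A ∷ B ∷ Δ) v          ∎
  where
  d = defect (Γ ⊢ Δ) v; a = ⟦ A ⟧ v; b = ⟦ B ⟧ v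
  p-[q+r]≡[p-r]-q : ∀ p q r → p - (q + r) ≡ (p - r) - q
  p-[q+r]≡[p-r]-q = solve 3 (λ p q r → p :- (q :+ r) := (p :- r) :- q) refl

defect-⇒l : ∀ Γ Δ A B v →
  defect (Γ ++ (A ⟹ B) ∷ [] ⊢ Δ) v ≡ defect (Γ ++ B ∷ (B ⟹ A) ∷ [] ⊢ Δ ++ A ∷ []) v
defect-⇒l Γ Δ A B v = begin
  defect (Γ ++ (A ⟹ B) ∷ [] ⊢ Δ) v                  ≡⟨ defect-ante-∷ʳ Γ (A ⟹ B) Δ v ⟩
  d + 0ℚ ⊓ (b - a)                                   ≡⟨ cong (d +_) (0⊓[q-p]≡q-p+0⊓[p-q] a b) ⟩
  d + ((b - a) + m)                                  ≡⟨ shuffle d a b m ⟩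
  ((d + b) + m) - a                                  ≡⟨ cong (λ x → (x + m) - a) (defect-ante-∷ʳ Γ B Δ v) ⟨
  (defect (Γ ++ B ∷ [] ⊢ Δ) v + m) - a               ≡⟨ cong (_- a) (defect-ante-∷ʳ (Γ ++ B ∷ []) (B ⟹ A) Δ v) ⟨
  defect ((Γ ++ B ∷ []) ++ (B ⟹ A) ∷ [] ⊢ Δ) v - a  ≡⟨ cong (λ Π → defect (Π ⊢ Δ) v - a) (++-assoc Γ (B ∷ []) ((B ⟹ A) ∷ [])) ⟩
  defect (Γ ++ B ∷ (B ⟹ A) ∷ [] ⊢ Δ) v - a          ≡⟨ defect-succ-∷ʳ (Γ ++ B ∷ (B ⟹ A) ∷ []) Δ A v ⟨
  defect (Γ ++ B ∷ (B ⟹ A) ∷ [] ⊢ Δ ++ A ∷ []) v    ∎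
  where
  d = defect (Γ ⊢ Δ) v; a = ⟦ A ⟧ v; b = ⟦ B ⟧ v; m = 0ℚ ⊓ (a - b)
  shuffle : ∀ d a b m → d + ((b - a) + m) ≡ ((d + b) + m) - a
  shuffle = solve 4 (λ d a b m → d :+ ((b :- a) :+ m) := ((d :+ b) :+ m) :- a) refl

defect-⇒r : ∀ Γ Δ A B v → defect (Γ ++ A ∷ [] ⊢ Δ ++ B ∷ []) v ≡ defect (Γ ⊢ Δ) v - (⟦ B ⟧ v - ⟦ A ⟧ v)
defect-⇒r Γ Δ A B v = begin
  defect (Γ ++ A ∷ [] ⊢ Δ ++ B ∷ []) v   ≡⟨ defect-succ-∷ʳ (Γ ++ A ∷ []) Δ B v ⟩
  defect (Γ ++ A ∷ [] ⊢ Δ) v - b         ≡⟨ cong (_- b) (defect-ante-∷ʳ Γ A Δ v) ⟩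
  (d + a) - b                            ≡⟨ p-[q-r]≡[p+r]-q d b a ⟨
  d - (b - a)                            ∎
  where
  d = defect (Γ ⊢ Δ) v; a = ⟦ A ⟧ v; b = ⟦ B ⟧ v

defect≤0 : ∀ {S} → GAs S → ∀ v → defect S v ≤ 0ℚ
defect≤0 (perm Γ↭Γ' Δ↭Δ' d) v = subst (_≤ 0ℚ) (defect-↭ Γ↭Γ' Δ↭Δ' v) (defect≤0 d v)
defect≤0 (ax {A}) v = p≤q⇒p-q≤0 (≤-refl {Σ⟦ A ∷ [] ⟧ v})
defect≤0 empty v = ≤-refl
defect≤0 (W {Γ} {Δ} {A} {B} d) v = subst (_≤ 0ℚ) (sym (defect-ante-∷ʳ Γ (A ⟹ B) Δ v))
  (+-mono-≤ (defect≤0 d v) (p⊓q≤p 0ℚ (⟦ B ⟧ v - ⟦ A ⟧ v)))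
defect≤0 (M {Γ₁} {Δ₁} {Γ₂} {Δ₂} d e) v = subst (_≤ 0ℚ) (sym (defect-++ Γ₁ Γ₂ Δ₁ Δ₂ v))
  (+-mono-≤ (defect≤0 d v) (defect≤0 e v))
defect≤0 (C {Γ} {Δ} n d) v = copies-defect-nonpos n Γ Δ v (defect≤0 d v)
defect≤0 (tl {Γ} {Δ} d) v = subst (_≤ 0ℚ) (sym (defect-tl Γ Δ v)) (defect≤0 d v)
defect≤0 (tr {Γ} {Δ} d) v = subst (_≤ 0ℚ) (sym (defect-tr Γ Δ v)) (defect≤0 d v)
defect≤0 (¬l {Γ} {Δ} {A} d) v = subst (_≤ 0ℚ) (sym (defect-¬l Γ Δ A v)) (defect≤0 d v)
defect≤0 (¬r {Γ} {Δ} {A} d) v = subst (_≤ 0ℚ) (sym (defect-¬r Γ Δ A v)) (defect≤0 d v)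
defect≤0 (→l {Γ} {Δ} {A} {B} d) v = subst (_≤ 0ℚ) (sym (defect-→l Γ Δ A B v)) (defect≤0 d v)
defect≤0 (→r {Γ} {Δ} {A} {B} d) v = subst (_≤ 0ℚ) (sym (defect-→r Γ Δ A B v)) (defect≤0 d v)
defect≤0 (+l {Γ} {Δ} {A} {B} d) v = subst (_≤ 0ℚ) (sym (defect-+l Γ Δ A B v)) (defect≤0 d v)
defect≤0 (+r {Γ} {Δ} {A} {B} d) v = subst (_≤ 0ℚ) (sym (defect-+r Γ Δ A B v)) (defect≤0 d v)
defect≤0 (⇒l {Γ} {Δ} {A} {B} d) v = subst (_≤ 0ℚ) (sym (defect-⇒l Γ Δ A B v)) (defect≤0 d v)
defect≤0 (⇒r {Γ} {Δ} {A} {B} d e) v = subst (_≤ 0ℚ) (sym (defect-succ-∷ʳ Γ Δ (A ⟹ B) v))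
  (p≤q⇒p-q≤0 (⊓-glb (defect≤0 d v) (p-q≤0⇒p≤q (subst (_≤ 0ℚ) (defect-⇒r Γ Δ A B v) (defect≤0 e v)))))

mainTheorem18 : (S : Sequent) → GAs S → ⊨A S
mainTheorem18 (Γ ⊢ Δ) d v = p-q≤0⇒p≤q (defect≤0 d v)
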